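{- For all integers $n\ge3$, \[T_{n+1}T_{n-1}=2\sum_{l=3}^nT_{l-1}T_{n-l+2}^2.\]
   Context: Tribonacci numbers: $T_n=T_{n-1}+T_{n-2}+T_{n-3}+\delta_{n,2}$ for all integers $n$, with $T_n=0$ for $n<2$; $\delta_{i,j}$ is $1$ if $i=j$ and $0$ otherwise. -}

module Defs where

open import Data.Nat using (ℕ; zero; suc; _+_; _*_; _∸_; _^_)

-- Tribonacci numbers T_n for n ≥ 0 (T_n = 0 for n < 2, T_2 = 1,
-- T_n = T_{n-1} + T_{n-2} + T_{n-3} otherwise). Negative indices are
-- never needed in the statement (all indices used are ≥ 2).
T : ℕ → ℕ
T 0 = 0
T 1 = 0
T 2 = 1
T (suc (suc (suc n))) = T (suc (suc n)) + T (suc n) + T n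

sumFrom : ℕ → ℕ → (ℕ → ℕ) → ℕ
sumFrom a zero f = 0
sumFrom a (suc k) f = f a + sumFrom (suc a) k f

-- Σ_{l=a}^{b} f l  (empty, i.e. 0, if b < a)
Σ[_⋯_] : ℕ → ℕ → (ℕ → ℕ) → ℕ
Σ[ a ⋯ b ] f = sumFrom a (suc b ∸ a) f

{-# OPTIONS --safe #-}
-- Put N = n - 1. The left side T (N+2) T N satisfies the forced recurrence
-- u (N+3) = u (N+2) + u (N+1) + u N + 2 T (N+3)², a polynomial identity in
-- three consecutive tribonacci numbers. The right side is the convolution of T
-- with k ↦ 2 T (k+2)², and since T is the impulse response of the tribonacci
-- recurrence (T 0 = T 1 = 0, T 2 = 1) this convolution satisfies the same forced
-- recurrence. Both sequences start 0, 0, 2, so they coincide.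
module Submission where

open import Defs
open import Data.Nat using (ℕ; zero; suc; _+_; _*_; _∸_; _^_; _≥_; _<_; s≤s; z<s)
open import Data.Nat.Properties using (+-comm; *-identityʳ; +-∸-comm; *-distribʳ-+)
open import Data.Nat.Tactic.RingSolver using (solve-∀)
open import Relation.Binary.PropositionalEquality using (_≡_; refl; cong; cong₂)
open Relation.Binary.PropositionalEquality.≡-Reasoning

sumFrom-suc : ∀ a k (f : ℕ → ℕ) → sumFrom (suc a) k f ≡ sumFrom a k (λ i → f (suc i))
sumFrom-suc a zero    f = refl
sumFrom-suc a (suc k) f = cong (f (suc a) +_) (sumFrom-suc (suc a) k f)

sumFrom-shift : ∀ b a k (f : ℕ → ℕ) → sumFrom (b + a) k f ≡ sumFrom a k (λ i → f (b + i))
sumFrom-shift zero    a k f = refl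
sumFrom-shift (suc b) a k f = begin
  sumFrom (suc (b + a)) k f            ≡⟨ sumFrom-suc (b + a) k f ⟩
  sumFrom (b + a) k (λ i → f (suc i))  ≡⟨ sumFrom-shift b a k (λ i → f (suc i)) ⟩
  sumFrom a k (λ i → f (suc b + i))    ∎

sumFrom-cong< : ∀ k {f h : ℕ → ℕ} → (∀ i → i < k → f i ≡ h i) → sumFrom 0 k f ≡ sumFrom 0 k h
sumFrom-cong< zero    f≡h = refl
sumFrom-cong< (suc k) {f} {h} f≡h = begin
  f 0 + sumFrom 1 k f                  ≡⟨ cong₂ _+_ (f≡h 0 z<s) (sumFrom-suc 0 k f) ⟩
  h 0 + sumFrom 0 k (λ i → f (suc i))  ≡⟨ cong (h 0 +_) (sumFrom-cong< k (λ i i<k → f≡h (suc i) (s≤s i<k))) ⟩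
  h 0 + sumFrom 0 k (λ i → h (suc i))  ≡⟨ cong (h 0 +_) (sumFrom-suc 0 k h) ⟨
  h 0 + sumFrom 1 k h                  ∎

sumFrom-cong : ∀ a k {f h : ℕ → ℕ} → (∀ i → f i ≡ h i) → sumFrom a k f ≡ sumFrom a k h
sumFrom-cong a zero    f≡h = refl
sumFrom-cong a (suc k) f≡h = cong₂ _+_ (f≡h a) (sumFrom-cong (suc a) k f≡h)

sumFrom-+ : ∀ a k (f h : ℕ → ℕ) → sumFrom a k (λ i → f i + h i) ≡ sumFrom a k f + sumFrom a k h
sumFrom-+ a zero    f h = refl
sumFrom-+ a (suc k) f h = begin
  f a + h a + sumFrom (suc a) k (λ i → f i + h i)
    ≡⟨ cong (f a + h a +_) (sumFrom-+ (suc a) k f h) ⟩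
  f a + h a + (sumFrom (suc a) k f + sumFrom (suc a) k h)
    ≡⟨ interchange (f a) (h a) (sumFrom (suc a) k f) (sumFrom (suc a) k h) ⟩
  f a + sumFrom (suc a) k f + (h a + sumFrom (suc a) k h) ∎
  where
  interchange : ∀ w x y z → w + x + (y + z) ≡ w + y + (x + z)
  interchange = solve-∀

_⋆_ : (ℕ → ℕ) → (ℕ → ℕ) → ℕ → ℕ
(f ⋆ g) N = Σ[ 0 ⋯ N ] (λ i → f i * g (N ∸ i))

TribonacciRecurrence : (ℕ → ℕ) → (ℕ → ℕ) → Set
TribonacciRecurrence e u = ∀ N → u (3 + N) ≡ u (2 + N) + u (1 + N) + u N + e N

tribonacciRecurrence-unique : ∀ {e u v : ℕ → ℕ} →
  TribonacciRecurrence e u → TribonacciRecurrence e v →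
  u 0 ≡ v 0 → u 1 ≡ v 1 → u 2 ≡ v 2 → ∀ N → u N ≡ v N
tribonacciRecurrence-unique ru rv u₀ u₁ u₂ 0 = u₀
tribonacciRecurrence-unique ru rv u₀ u₁ u₂ 1 = u₁
tribonacciRecurrence-unique ru rv u₀ u₁ u₂ 2 = u₂
tribonacciRecurrence-unique {e} {u} {v} ru rv u₀ u₁ u₂ (suc (suc (suc N))) = begin
  u (3 + N)                                ≡⟨ ru N ⟩
  u (2 + N) + u (1 + N) + u N + e N        ≡⟨ cong (_+ e N) (cong₂ _+_ (cong₂ _+_ (u≡v (suc (suc N))) (u≡v (suc N))) (u≡v N)) ⟩
  v (2 + N) + v (1 + N) + v N + e N        ≡⟨ rv N ⟨
  v (3 + N)                                ∎
  where
  u≡v : ∀ M → u M ≡ v M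
  u≡v = tribonacciRecurrence-unique ru rv u₀ u₁ u₂

tribonacciRecurrence-scale : ∀ k {e u : ℕ → ℕ} → TribonacciRecurrence e u →
  TribonacciRecurrence (λ N → k * e N) (λ N → k * u N)
tribonacciRecurrence-scale k {e} {u} ru N = begin
  k * u (3 + N)                                    ≡⟨ cong (k *_) (ru N) ⟩
  k * (u (2 + N) + u (1 + N) + u N + e N)          ≡⟨ distrib k (u (2 + N)) (u (1 + N)) (u N) (e N) ⟩
  k * u (2 + N) + k * u (1 + N) + k * u N + k * e N ∎
  where
  distrib : ∀ k a b c d → k * (a + b + c + d) ≡ k * a + k * b + k * c + k * d
  distrib = solve-∀

-- Unfolding (T ⋆ g) (3 + N), the terms with T 0 and T 1 vanish and
-- T 2 * g (1 + N) remains; the recurrence of T splits the rest into the three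
-- previous convolutions.
T⋆-tribonacciRecurrence : ∀ g → TribonacciRecurrence (λ N → g (1 + N)) (T ⋆ g)
T⋆-tribonacciRecurrence g N = begin
  1 * g (1 + N) + sumFrom 3 (1 + N) (λ i → T i * g (3 + N ∸ i))
    ≡⟨ cong (1 * g (1 + N) +_) (sumFrom-shift 3 0 (1 + N) _) ⟩
  1 * g (1 + N) + sumFrom 0 (1 + N) (λ i → T (3 + i) * g (N ∸ i))
    ≡⟨ cong (1 * g (1 + N) +_) (sumFrom-cong 0 (1 + N) distribute) ⟩
  1 * g (1 + N) + sumFrom 0 (1 + N) (λ i → x₂ i + x₁ i + x₀ i)
    ≡⟨ cong (1 * g (1 + N) +_) (split3 (1 + N)) ⟩
  1 * g (1 + N) + (sumFrom 0 (1 + N) x₂ + sumFrom 0 (1 + N) x₁ + sumFrom 0 (1 + N) x₀)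
    ≡⟨ cong (λ s → 1 * g (1 + N) + (s + sumFrom 0 (1 + N) x₁ + sumFrom 0 (1 + N) x₀))
            (sumFrom-shift 2 0 (1 + N) (λ i → T i * g (2 + N ∸ i))) ⟨
  1 * g (1 + N) + (sumFrom 2 (1 + N) (λ i → T i * g (2 + N ∸ i)) + sumFrom 0 (1 + N) x₁ + sumFrom 0 (1 + N) x₀)
    ≡⟨ cong (λ s → 1 * g (1 + N) + (sumFrom 2 (1 + N) (λ i → T i * g (2 + N ∸ i)) + s + sumFrom 0 (1 + N) x₀))
            (sumFrom-suc 0 (1 + N) (λ i → T i * g (1 + N ∸ i))) ⟨
  1 * g (1 + N) + ((T ⋆ g) (2 + N) + (T ⋆ g) (1 + N) + (T ⋆ g) N)
    ≡⟨ rotate (g (1 + N)) ((T ⋆ g) (2 + N)) ((T ⋆ g) (1 + N)) ((T ⋆ g) N) ⟩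
  (T ⋆ g) (2 + N) + (T ⋆ g) (1 + N) + (T ⋆ g) N + g (1 + N) ∎
  where
  x₂ x₁ x₀ : ℕ → ℕ
  x₂ i = T (2 + i) * g (N ∸ i)
  x₁ i = T (1 + i) * g (N ∸ i)
  x₀ i = T i * g (N ∸ i)

  distribute : ∀ i → T (3 + i) * g (N ∸ i) ≡ x₂ i + x₁ i + x₀ i
  distribute i = begin
    (T (2 + i) + T (1 + i) + T i) * g (N ∸ i)     ≡⟨ *-distribʳ-+ (g (N ∸ i)) (T (2 + i) + T (1 + i)) (T i) ⟩
    (T (2 + i) + T (1 + i)) * g (N ∸ i) + x₀ i    ≡⟨ cong (_+ x₀ i) (*-distribʳ-+ (g (N ∸ i)) (T (2 + i)) (T (1 + i))) ⟩
    x₂ i + x₁ i + x₀ i                            ∎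

  split3 : ∀ k → sumFrom 0 k (λ i → x₂ i + x₁ i + x₀ i) ≡ sumFrom 0 k x₂ + sumFrom 0 k x₁ + sumFrom 0 k x₀
  split3 k = begin
    sumFrom 0 k (λ i → x₂ i + x₁ i + x₀ i)            ≡⟨ sumFrom-+ 0 k (λ i → x₂ i + x₁ i) x₀ ⟩
    sumFrom 0 k (λ i → x₂ i + x₁ i) + sumFrom 0 k x₀  ≡⟨ cong (_+ sumFrom 0 k x₀) (sumFrom-+ 0 k x₂ x₁) ⟩
    sumFrom 0 k x₂ + sumFrom 0 k x₁ + sumFrom 0 k x₀  ∎

  rotate : ∀ z a b c → 1 * z + (a + b + c) ≡ a + b + c + z
  rotate = solve-∀

tribonacci-product-identity : ∀ a b c →
  let t₃ = c + b + a
      t₄ = t₃ + c + b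
      t₅ = t₄ + t₃ + c
  in t₅ * t₃ ≡ t₄ * c + t₃ * b + c * a + 2 * (t₃ * t₃)
tribonacci-product-identity = solve-∀

T-product-tribonacciRecurrence :
  TribonacciRecurrence (λ N → 2 * T (3 + N) ^ 2) (λ N → T (2 + N) * T N)
T-product-tribonacciRecurrence N = begin
  T (5 + N) * T (3 + N)
    ≡⟨ tribonacci-product-identity (T N) (T (1 + N)) (T (2 + N)) ⟩
  T (4 + N) * T (2 + N) + T (3 + N) * T (1 + N) + T (2 + N) * T N + 2 * (T (3 + N) * T (3 + N))
    ≡⟨ cong (λ s → T (4 + N) * T (2 + N) + T (3 + N) * T (1 + N) + T (2 + N) * T N + 2 * (T (3 + N) * s))
            (*-identityʳ (T (3 + N))) ⟨
  T (4 + N) * T (2 + N) + T (3 + N) * T (1 + N) + T (2 + N) * T N + 2 * T (3 + N) ^ 2 ∎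

T-product≡T⋆squares : ∀ N → T (2 + N) * T N ≡ 2 * (T ⋆ λ k → T (2 + k) ^ 2) N
T-product≡T⋆squares = tribonacciRecurrence-unique
  {u = λ N → T (2 + N) * T N} {v = λ N → 2 * (T ⋆ λ k → T (2 + k) ^ 2) N}
  T-product-tribonacciRecurrence
  (tribonacciRecurrence-scale 2 {u = T ⋆ λ k → T (2 + k) ^ 2} (T⋆-tribonacciRecurrence (λ k → T (2 + k) ^ 2)))
  refl refl refl

T⋆squares≡Σ : ∀ m →
  (T ⋆ λ k → T (2 + k) ^ 2) (2 + m) ≡ Σ[ 3 ⋯ 3 + m ] (λ l → T (l ∸ 1) * T (3 + m + 2 ∸ l) ^ 2)
T⋆squares≡Σ m = begin
  sumFrom 2 (1 + m) (λ i → T i * T (2 + (2 + m ∸ i)) ^ 2)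
    ≡⟨ sumFrom-shift 2 0 (1 + m) _ ⟩
  sumFrom 0 (1 + m) (λ i → T (2 + i) * T (2 + (m ∸ i)) ^ 2)
    ≡⟨ sumFrom-cong< (1 + m) reflect ⟩
  sumFrom 0 (1 + m) (λ i → T (2 + i) * T (m + 2 ∸ i) ^ 2)
    ≡⟨ sumFrom-shift 3 0 (1 + m) _ ⟨
  sumFrom 3 (1 + m) (λ l → T (l ∸ 1) * T (3 + m + 2 ∸ l) ^ 2) ∎
  where
  reflect : ∀ i → i < 1 + m → T (2 + i) * T (2 + (m ∸ i)) ^ 2 ≡ T (2 + i) * T (m + 2 ∸ i) ^ 2
  reflect i (s≤s i≤m) = cong (λ k → T (2 + i) * T k ^ 2) (begin
    2 + (m ∸ i)  ≡⟨ +-comm 2 (m ∸ i) ⟩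
    m ∸ i + 2    ≡⟨ +-∸-comm 2 i≤m ⟨
    m + 2 ∸ i    ∎)

mainTheorem16 : (n : ℕ) → n ≥ 3 →
    T (n + 1) * T (n ∸ 1) ≡ 2 * Σ[ 3 ⋯ n ] (λ l → T (l ∸ 1) * T (n + 2 ∸ l) ^ 2)
mainTheorem16 (suc (suc (suc m))) (s≤s (s≤s (s≤s _))) = begin
  T (3 + m + 1) * T (2 + m)                   ≡⟨ cong (λ k → T k * T (2 + m)) (+-comm (3 + m) 1) ⟩
  T (4 + m) * T (2 + m)                       ≡⟨ T-product≡T⋆squares (2 + m) ⟩
  2 * (T ⋆ λ k → T (2 + k) ^ 2) (2 + m)       ≡⟨ cong (2 *_) (T⋆squares≡Σ m) ⟩
  2 * Σ[ 3 ⋯ 3 + m ] (λ l → T (l ∸ 1) * T (3 + m + 2 ∸ l) ^ 2) ∎
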